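{- Let $G$ be an OC-irreducible finite graph with $\mathcal{H}(G)$ edgeless and $\Delta(G)=\delta(G)+1$, and write $\delta=\delta(G)$. Then (1) $\operatorname{mic}(G)<|\mathcal{H}(G)|+|G|$; and (2) $(\delta-1)|\mathcal{H}(G)|<|\mathcal{L}(G)|$ and $2\|G\|<\bigl(\delta+\frac1\delta\bigr)|G|$.
   Context: $\mathcal{H}(G)$ is the subgraph induced on vertices of degree greater than $\delta(G)$; $\mathcal{L}(G)$ is the subgraph induced on vertices of degree $\delta(G)$. $|G|$, $\|G\|$ are numbers of vertices and edges. $\operatorname{mic}(G)$ is the maximum of $\sum_{v\in I}d_G(v)$ over independent sets $I$. $G$ is OC-reducible to $H$ if $H$ is a nonempty induced subgraph of $G$ that is online $f_H$-choosable, where $f_H(v)=\delta(G)+d_H(v)-d_G(v)$; $G$ is OC-irreducible if it is OC-reducible to no nonempty induced subgraph. Online $f$-choosability: $G$ is online $f$-choosable if $|G|=0$, or both $f(v)\ge1$ for all $v$ and for every $S\subseteq V(G)$ there is an independent $I\subseteq S$ such that $G-I$ is online $f'$-choosable, where $f'(v)=f(v)$ for $v\notin S$ and $f'(v)=f(v)-1$ for $v\in S\setminus I$. -}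

module Defs where

open import Data.Bool using (Bool; true; false; if_then_else_; _∧_; not)
open import Data.Nat using (ℕ; zero; suc; _+_; _∸_; _⊓_; _⊔_; _≤_; _<ᵇ_; _≡ᵇ_)
open import Data.Fin using (Fin; toℕ) renaming (zero to fz; suc to fs)
open import Data.List using (List; []; _∷_; foldr; concatMap)
open import Data.Product using (Σ; ∃; _×_)
open import Relation.Binary.PropositionalEquality using (_≡_)
open import Relation.Nullary using (¬_)
open import Function using (_∘_)

record Graph (n : ℕ) : Set where
  field
    adj    : Fin n → Fin n → Bool
    sym    : ∀ u v → adj u v ≡ adj v u
    irrefl : ∀ v → adj v v ≡ false
open Graph public

VSet : ℕ → Set
VSet n = Fin n → Bool

count : ∀ {n} → VSet n → ℕ
count {zero}  p = 0
count {suc n} p = (if p fz then 1 else 0) + count (p ∘ fs)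

sumOver : ∀ {n} → VSet n → (Fin n → ℕ) → ℕ
sumOver {zero}  p g = 0
sumOver {suc n} p g = (if p fz then g fz else 0) + sumOver (p ∘ fs) (g ∘ fs)

_⊆_ : ∀ {n} → VSet n → VSet n → Set
S ⊆ U = ∀ v → S v ≡ true → U v ≡ true

Nonempty : ∀ {n} → VSet n → Set
Nonempty S = ∃ λ v → S v ≡ true

_minus_ : ∀ {n} → VSet n → VSet n → VSet n
(U minus I) v = U v ∧ not (I v)

full : ∀ {n} → VSet n
full v = true

deg : ∀ {n} → Graph n → Fin n → ℕ
deg G v = count (adj G v)

degIn : ∀ {n} → Graph n → VSet n → Fin n → ℕ
degIn G U v = count (λ u → U u ∧ adj G v u)

minF : ∀ {n} → (Fin (suc n) → ℕ) → ℕ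
minF {zero}  f = f fz
minF {suc n} f = f fz ⊓ minF (f ∘ fs)

maxF : ∀ {n} → (Fin n → ℕ) → ℕ
maxF {zero}  f = 0
maxF {suc n} f = f fz ⊔ maxF (f ∘ fs)

-- δ(G) and Δ(G)  (convention: 0 for the empty graph)
mindeg : ∀ {n} → Graph n → ℕ
mindeg {zero}  G = 0
mindeg {suc n} G = minF (deg G)

maxdeg : ∀ {n} → Graph n → ℕ
maxdeg G = maxF (deg G)

Hset : ∀ {n} → Graph n → VSet n
Hset G v = mindeg G <ᵇ deg G v

Lset : ∀ {n} → Graph n → VSet n
Lset G v = deg G v ≡ᵇ mindeg G

numEdges : ∀ {n} → Graph n → ℕ
numEdges {n} G = sumOver {n} full (λ u → count (λ v → (toℕ u <ᵇ toℕ v) ∧ adj G u v))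

Independent : ∀ {n} → Graph n → VSet n → Set
Independent G I = ∀ u v → I u ≡ true → I v ≡ true → adj G u v ≡ false

HEdgeless : ∀ {n} → Graph n → Set
HEdgeless G = Independent G (Hset G)

allF : ∀ {n} → (Fin n → Bool) → Bool
allF {zero}  p = true
allF {suc n} p = p fz ∧ allF (p ∘ fs)

independentᵇ : ∀ {n} → Graph n → VSet n → Bool
independentᵇ G I = allF (λ u → allF (λ v → not (I u ∧ I v ∧ adj G u v)))

cons : ∀ {n} → Bool → VSet n → VSet (suc n)
cons b S fz     = b
cons b S (fs v) = S v

allSubsets : ∀ n → List (VSet n)
allSubsets zero    = (λ ()) ∷ []
allSubsets (suc n) = concatMap (λ S → cons false S ∷ cons true S ∷ []) (allSubsets n)

mic : ∀ {n} → Graph n → ℕ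
mic {n} G =
  foldr (λ I m → if independentᵇ G I then sumOver I (deg G) ⊔ m else m) 0 (allSubsets n)

-- Online f-choosability of the induced subgraph G[U] (f only matters on U).
-- S ranges over NONEMPTY subsets of U.
data OnlineChoosable {n} (G : Graph n) : VSet n → (Fin n → ℕ) → Set where
  oc-empty : ∀ {U f} → (∀ v → U v ≡ false) → OnlineChoosable G U f
  oc-step  : ∀ {U f} →
    (∀ v → U v ≡ true → 1 ≤ f v) →
    (∀ S → S ⊆ U → Nonempty S →
       Σ (VSet n) λ I → I ⊆ S × Independent G I ×
         OnlineChoosable G (U minus I) (λ v → if S v then f v ∸ 1 else f v)) →
    OnlineChoosable G U f

fH : ∀ {n} → Graph n → VSet n → Fin n → ℕ
fH G U v = mindeg G + degIn G U v ∸ deg G v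

OCReducibleTo : ∀ {n} → Graph n → VSet n → Set
OCReducibleTo G U = Nonempty U × OnlineChoosable G U (fH G U)

OCIrreducible : ∀ {n} → Graph n → Set
OCIrreducible G = ∀ U → ¬ OCReducibleTo G U

-- Fix an independent set I and orient every edge meeting I, the other edges staying two-way;
-- initially all point away from I, so the in-degrees sum to Σ_{v∈I} d(v). Demand in-degree
-- g(v) = 1 + [v ∈ 𝓗(G)]. If Σ_{v∈I} d(v) ≥ |𝓗(G)| + |G|, reversing paths from deficient to
-- surplus vertices decreases the total deficiency until the vertices not reachable from a
-- deficient vertex form a nonempty set W, closed under in-neighbours, meeting every demand.
-- The digraph has a kernel on every vertex set (grown from semikernels: a vertex outside I with
-- no arc into I, or the part in I), so by the kernel method G[W] is online f-choosable whenever
-- f exceeds the out-degree in W. Since d_W(v) = outdeg_W(v) + indeg(v) and d(v) = δ + [v ∈ 𝓗(G)],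
-- f_W does exceed it, contradicting OC-irreducibility. Hence Σ_{v∈I} d(v) < |𝓗(G)| + |G|, which
-- is (1); the case I = 𝓗(G) gives δ|𝓗(G)| < |G| = |𝓗(G)| + |𝓛(G)|, and with 2‖G‖ = δ|G| + |𝓗(G)|
-- this is (2).

module Submission where

open import Defs hiding (sym)
import Algebra.Properties.CommutativeMonoid.Sum
open import Data.Bool using (Bool; true; false; if_then_else_; _∧_; _∨_; not)
open import Data.Bool.Properties
  using (T-≡; ∧-conicalˡ; ∧-conicalʳ; ∧-zeroʳ; ∨-zeroʳ; ∨-identityʳ; ∨-comm; ∨-conicalˡ; ∨-conicalʳ; ¬-not; not-injective)
  renaming (_≟_ to _≟ᵇ_)
open import Data.Empty using (⊥; ⊥-elim)
open import Data.Fin using (Fin; toℕ) renaming (zero to fz; suc to fs)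
open import Data.Fin.Properties using (any?; toℕ-injective) renaming (_≟_ to _≟ᶠ_)
import Data.Fin.Properties as Fin
open import Data.Integer using (+_; +<+; -<+) renaming (_+_ to _+ℤ_; _*_ to _*ℤ_; _-_ to _-ℤ_; _<_ to _<ℤ_)
import Data.Integer.Properties as ℤ
open import Data.Integer.GCD using (gcd)
open import Data.List using ([]; _∷_; foldr)
open import Data.Nat
  using (ℕ; zero; suc; _+_; _*_; _∸_; _⊔_; _<_; _≤_; _<ᵇ_; _≤?_; _<?_; z≤n; s≤s; NonZero; ≢-nonZero⁻¹)
open import Data.Nat.Properties
open import Data.Nat.Tactic.RingSolver using (solve-∀)
open import Data.Product using (∃; _×_; _,_; proj₁; proj₂)
open import Data.Rational using (_/_; ↥_; ↧_; toℚᵘ) renaming (_+_ to _+ℚ_; _*_ to _*ℚ_; _<_ to _<ℚ_)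
open import Data.Rational.Properties using (↥ᵘ-toℚᵘ; ↧ᵘ-toℚᵘ; ↥-/; ↧-/; toℚᵘ-cancel-<; toℚᵘ-homo-+; toℚᵘ-homo-*)
open import Data.Rational.Unnormalised as ℚᵘ using (mkℚᵘ; *≡*; *<*; _≃_) renaming (↥_ to ↥ᵘ_; ↧_ to ↧ᵘ_)
import Data.Rational.Unnormalised.Properties as ℚᵘ
open import Data.Sum using (_⊎_; inj₁; inj₂)
open import Function using (_∘_; case_of_; Equivalence)
open import Relation.Binary.Definitions using (tri<; tri≈; tri>)
open import Relation.Binary.PropositionalEquality
open import Relation.Nullary using (Dec; yes; no; does)

open Algebra.Properties.CommutativeMonoid.Sum +-0-commutativeMonoid using (sum; sum-cong-≗; ∑-distrib-+; ∑-comm)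
open import Algebra.Properties.CommutativeSemigroup ℤ.*-commutativeSemigroup using (x∙yz≈xz∙y)

-- Vertex sets and counting

𝟙 : Bool → ℕ
𝟙 b = if b then 1 else 0

sum-const : ∀ n c → sum {n} (λ _ → c) ≡ n * c
sum-const zero    c = refl
sum-const (suc n) c = cong (_+_ c) (sum-const n c)

sum-*ʳ : ∀ {n} (f : Fin n → ℕ) c → sum (λ v → f v * c) ≡ sum f * c
sum-*ʳ {zero}  f c = refl
sum-*ʳ {suc n} f c = trans (cong (_+_ (f fz * c)) (sum-*ʳ (f ∘ fs) c)) (sym (*-distribʳ-+ c (f fz) _))

sum-mono-≤ : ∀ {n} {f h : Fin n → ℕ} → (∀ v → f v ≤ h v) → sum f ≤ sum h
sum-mono-≤ {zero}  f≤h = z≤n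
sum-mono-≤ {suc n} f≤h = +-mono-≤ (f≤h fz) (sum-mono-≤ (f≤h ∘ fs))

sum-mono-< : ∀ {n} {f h : Fin n → ℕ} → (∀ v → f v ≤ h v) → ∀ a → f a < h a → sum f < sum h
sum-mono-< f≤h fz     fa<ha = +-mono-<-≤ fa<ha (sum-mono-≤ (f≤h ∘ fs))
sum-mono-< f≤h (fs a) fa<ha = +-mono-≤-< (f≤h fz) (sum-mono-< (f≤h ∘ fs) a fa<ha)

sum-suc-at : ∀ {n} (f h : Fin n → ℕ) a → f a ≡ suc (h a) → (∀ x → x ≢ a → f x ≡ h x) → sum f ≡ suc (sum h)
sum-suc-at f h fz     fa≡ha+1 f≗h = cong₂ _+_ fa≡ha+1 (sum-cong-≗ (λ x → f≗h (fs x) λ ()))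
sum-suc-at f h (fs a) fa≡ha+1 f≗h = trans
  (cong₂ _+_ (f≗h fz λ ()) (sum-suc-at (f ∘ fs) (h ∘ fs) a fa≡ha+1 (λ x x≢a → f≗h (fs x) (x≢a ∘ Fin.suc-injective))))
  (+-suc (h fz) _)

count≡sum𝟙 : ∀ {n} (p : VSet n) → count p ≡ sum (𝟙 ∘ p)
count≡sum𝟙 {zero}  p = refl
count≡sum𝟙 {suc n} p = cong (_+_ (𝟙 (p fz))) (count≡sum𝟙 (p ∘ fs))

sumOver≡sum : ∀ {n} (p : VSet n) g → sumOver p g ≡ sum (λ v → if p v then g v else 0)
sumOver≡sum {zero}  p g = refl
sumOver≡sum {suc n} p g = cong (_+_ (if p fz then g fz else 0)) (sumOver≡sum (p ∘ fs) (g ∘ fs))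

𝟙-mono : ∀ {a b} → (a ≡ true → b ≡ true) → 𝟙 a ≤ 𝟙 b
𝟙-mono {false} a⇒b = z≤n
𝟙-mono {true}  a⇒b rewrite a⇒b refl = ≤-refl

count-cong : ∀ {n} {p q : VSet n} → (∀ v → p v ≡ q v) → count p ≡ count q
count-cong {p = p} {q} p≗q = begin
  count p       ≡⟨ count≡sum𝟙 p ⟩
  sum (𝟙 ∘ p)   ≡⟨ sum-cong-≗ (cong 𝟙 ∘ p≗q) ⟩
  sum (𝟙 ∘ q)   ≡⟨ count≡sum𝟙 q ⟨
  count q       ∎
  where open ≡-Reasoning

count-mono-≤ : ∀ {n} {p q : VSet n} → p ⊆ q → count p ≤ count q
count-mono-≤ {p = p} {q} p⊆q rewrite count≡sum𝟙 p | count≡sum𝟙 q = sum-mono-≤ (λ v → 𝟙-mono (p⊆q v))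

count-mono-< : ∀ {n} {p q : VSet n} → p ⊆ q → ∀ a → q a ≡ true → p a ≡ false → count p < count q
count-mono-< {p = p} {q} p⊆q a qa pa rewrite count≡sum𝟙 p | count≡sum𝟙 q =
  sum-mono-< (λ v → 𝟙-mono (p⊆q v)) a (subst₂ (λ x y → 𝟙 x < 𝟙 y) (sym pa) (sym qa) ≤-refl)

count≤size : ∀ {n} (p : VSet n) → count p ≤ n
count≤size {zero}  p = z≤n
count≤size {suc n} p with p fz
... | true  = s≤s (count≤size (p ∘ fs))
... | false = m≤n⇒m≤1+n (count≤size (p ∘ fs))

count-pos : ∀ {n} (p : VSet n) → Nonempty p → 0 < count p
count-pos {n} p (a , pa) = subst (_< count p) (count-empty n) (count-mono-< {p = λ _ → false} (λ v ()) a pa refl)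
  where
  count-empty : ∀ n → count {n} (λ _ → false) ≡ 0
  count-empty zero    = refl
  count-empty (suc n) = count-empty n

count-suc-at : ∀ {n} (p q : VSet n) a → p a ≡ true → q a ≡ false → (∀ x → x ≢ a → p x ≡ q x) →
               count p ≡ suc (count q)
count-suc-at p q a pa qa p≗q rewrite count≡sum𝟙 p | count≡sum𝟙 q =
  sum-suc-at _ _ a (subst₂ (λ x y → 𝟙 x ≡ suc (𝟙 y)) (sym pa) (sym qa) refl) (λ x x≢a → cong 𝟙 (p≗q x x≢a))

𝟙-split : ∀ a b c → (c ≡ true → (a ∨ b) ≡ true) → (c ≡ true → a ≡ true → b ≡ true → ⊥) →
          𝟙 c ≡ 𝟙 (a ∧ c) + 𝟙 (b ∧ c)
𝟙-split a     b     false _      _        = sym (cong₂ _+_ (cong 𝟙 (∧-zeroʳ a)) (cong 𝟙 (∧-zeroʳ b)))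
𝟙-split true  true  true  _      ¬a∧b     = ⊥-elim (¬a∧b refl refl refl)
𝟙-split true  false true  _      _        = refl
𝟙-split false true  true  _      _        = refl
𝟙-split false false true  c⇒a∨b  _        with () ← c⇒a∨b refl

<ᵇ-true⇒< : ∀ {a b} → (a <ᵇ b) ≡ true → a < b
<ᵇ-true⇒< {a} {b} e = <ᵇ⇒< a b (Equivalence.from T-≡ e)

<ᵇ-false⇒≥ : ∀ {a b} → (a <ᵇ b) ≡ false → b ≤ a
<ᵇ-false⇒≥ {a} {b} e = ≮⇒≥ λ a<b → case trans (sym (Equivalence.to T-≡ (<⇒<ᵇ a<b))) e of λ ()

∃ᵇ : ∀ {n} → VSet n → Bool
∃ᵇ p = does (any? λ v → p v ≟ᵇ true)

∃ᵇ-witness : ∀ {n} {p : VSet n} → ∃ᵇ p ≡ true → Nonempty p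
∃ᵇ-witness {p = p} _ with any? (λ v → p v ≟ᵇ true)
... | yes w = w

∃ᵇ-intro : ∀ {n} {p : VSet n} v → p v ≡ true → ∃ᵇ p ≡ true
∃ᵇ-intro {p = p} v pv with any? (λ v → p v ≟ᵇ true)
... | yes _ = refl
... | no ¬∃ = ⊥-elim (¬∃ (v , pv))

∃ᵇ-false : ∀ {n} {p : VSet n} → ∃ᵇ p ≡ false → ∀ v → p v ≡ false
∃ᵇ-false {p = p} ¬∃ v with p v in pv
... | false = refl
... | true  with () ← trans (sym (∃ᵇ-intro v pv)) ¬∃

∧-intro : ∀ {a b} → a ≡ true → b ≡ true → (a ∧ b) ≡ true
∧-intro refl refl = refl

minus-⊆ : ∀ {n} (U K : VSet n) → (U minus K) ⊆ U
minus-⊆ U K v = ∧-conicalˡ (U v) _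

minus-removes : ∀ {n} (U K : VSet n) v → K v ≡ true → (U minus K) v ≡ false
minus-removes U K v Kv rewrite Kv = ∧-zeroʳ (U v)

｛_｝ : ∀ {n} → Fin n → VSet n
｛ v ｝ x = does (x ≟ᶠ v)

∈｛｝ : ∀ {n} {v x : Fin n} → ｛ v ｝ x ≡ true → x ≡ v
∈｛｝ {v = v} {x} _ with x ≟ᶠ v
... | yes x≡v = x≡v

∉｛｝ : ∀ {n} {v x : Fin n} → x ≢ v → ｛ v ｝ x ≡ false
∉｛｝ {v = v} {x} x≢v with x ≟ᶠ v
... | yes x≡v = ⊥-elim (x≢v x≡v)
... | no _    = refl

｛｝-self : ∀ {n} (v : Fin n) → ｛ v ｝ v ≡ true
｛｝-self v with v ≟ᶠ v
... | yes _   = refl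
... | no v≢v = ⊥-elim (v≢v refl)

-- Kernels and online choosability

Arcs : ℕ → Set
Arcs n = Fin n → Fin n → Bool

PredecessorClosed : ∀ {n} → Arcs n → VSet n → Set
PredecessorClosed o W = ∀ u v → o u v ≡ true → W v ≡ true → W u ≡ true

module KernelPerfection {n} (G : Graph n) (D : Arcs n) where

  Absorbs : VSet n → VSet n → Set
  Absorbs X K = ∀ v → X v ≡ true → K v ≡ false → ∃ λ w → K w ≡ true × D v w ≡ true

  Kernel : VSet n → VSet n → Set
  Kernel X K = K ⊆ X × Independent G K × Absorbs X K

  KernelPerfect : Set
  KernelPerfect = ∀ X → ∃ (Kernel X)

  kernel-nonempty : ∀ {X K} → Kernel X K → Nonempty X → Nonempty K
  kernel-nonempty {K = K} (_ , _ , absorbs) (x , Xx) with K x in Kx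
  ... | true  = x , Kx
  ... | false = let (w , Kw , _) = absorbs x Xx Kx in w , Kw

  outdegIn : VSet n → Fin n → ℕ
  outdegIn U v = count (λ u → U u ∧ D v u)

  outdegIn-minus-≤ : ∀ U K v → outdegIn (U minus K) v ≤ outdegIn U v
  outdegIn-minus-≤ U K v = count-mono-≤ λ u e →
    ∧-intro (minus-⊆ U K u (∧-conicalˡ _ _ e)) (∧-conicalʳ ((U minus K) u) _ e)

  outdegIn-minus-< : ∀ U K v w → K w ≡ true → U w ≡ true → D v w ≡ true → outdegIn (U minus K) v < outdegIn U v
  outdegIn-minus-< U K v w Kw Uw Dvw = count-mono-< (λ u e →
    ∧-intro (minus-⊆ U K u (∧-conicalˡ _ _ e)) (∧-conicalʳ ((U minus K) u) _ e)) w
      (∧-intro Uw Dvw) (trans (cong (_∧ D v w) (minus-removes U K w Kw)) refl)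

  -- Online form of the kernel lemma (Bondy–Boppana–Siegel): colour a kernel of the vertices S
  -- admitting the current colour; every other vertex of S loses one list entry but also an
  -- out-neighbour.
  kernelPerfect⇒onlineChoosable : KernelPerfect → ∀ U f →
    (∀ v → U v ≡ true → suc (outdegIn U v) ≤ f v) → OnlineChoosable G U f
  kernelPerfect⇒onlineChoosable kp U f = go (count U) U ≤-refl f
    where
    go : ∀ m U → count U ≤ m → ∀ f → (∀ v → U v ≡ true → suc (outdegIn U v) ≤ f v) → OnlineChoosable G U f
    go zero U |U|≤0 f _ = oc-empty λ v → ¬-not λ Uv → <⇒≱ (count-pos U (v , Uv)) |U|≤0
    go (suc m) U |U|≤m+1 f f>out = oc-step (λ v Uv → ≤-trans (s≤s z≤n) (f>out v Uv)) step
      where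
      step : ∀ S → S ⊆ U → Nonempty S → ∃ λ K → K ⊆ S × Independent G K ×
               OnlineChoosable G (U minus K) (λ v → if S v then f v ∸ 1 else f v)
      step S S⊆U S≠∅ = K , K⊆S , K-indep , go m (U minus K) |U∖K|≤m _ f'>out
        where
        K = proj₁ (kp S)
        K⊆S = proj₁ (proj₂ (kp S))
        K-indep = proj₁ (proj₂ (proj₂ (kp S)))
        K-absorbs = proj₂ (proj₂ (proj₂ (kp S)))
        |U∖K|≤m : count (U minus K) ≤ m
        |U∖K|≤m with (k , Kk) ← kernel-nonempty (proj₂ (kp S)) S≠∅ = ≤-pred (≤-trans
          (count-mono-< (minus-⊆ U K) k (S⊆U k (K⊆S k Kk)) (minus-removes U K k Kk)) |U|≤m+1)
        f'>out : ∀ v → (U minus K) v ≡ true → suc (outdegIn (U minus K) v) ≤ (if S v then f v ∸ 1 else f v)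
        f'>out v e with Uv ← minus-⊆ U K v e | S v in Sv
        ... | false = ≤-trans (s≤s (outdegIn-minus-≤ U K v)) (f>out v Uv)
        ... | true with K v in Kv
        ...   | true  with () ← trans (sym e) (∧-zeroʳ (U v))
        ...   | false with (w , Kw , Dvw) ← K-absorbs v Sv Kv = ≤-trans
          (outdegIn-minus-< U K v w Kw (S⊆U w (K⊆S w Kw)) Dvw)
          (∸-monoˡ-≤ 1 (f>out v Uv))

-- Orientations of the edges at an independent set

module Orientations {n} (G : Graph n) (I : VSet n) (I-indep : Independent G I) where

  -- Only the edges meeting I are oriented; the edges of G - I stay undirected.
  record IsOrientation (o : Arcs n) : Set where
    field
      arc⇒adj     : ∀ u v → o u v ≡ true → adj G u v ≡ true
      arc-meets-I : ∀ u v → o u v ≡ true → (I u ∨ I v) ≡ true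
      oriented    : ∀ u v → adj G u v ≡ true → (I u ∨ I v) ≡ true → o v u ≡ not (o u v)

  indeg : Arcs n → Fin n → ℕ
  indeg o v = count (λ u → o u v)

  outward : Arcs n
  outward u v = adj G u v ∧ I u

  outward-isOrientation : IsOrientation outward
  outward-isOrientation = record
    { arc⇒adj = λ u v e → ∧-conicalˡ (adj G u v) _ e
    ; arc-meets-I = λ u v e → cong (_∨ I v) (∧-conicalʳ (adj G u v) _ e)
    ; oriented = oriented
    }
    where
    oriented : ∀ u v → adj G u v ≡ true → (I u ∨ I v) ≡ true → (adj G v u ∧ I v) ≡ not (adj G u v ∧ I u)
    oriented u v uv meets rewrite Graph.sym G v u | uv with I u in Iu | I v in Iv
    ... | true  | true  = case trans (sym uv) (I-indep u v Iu Iv) of λ ()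
    ... | true  | false = refl
    ... | false | true  = refl

  module Oriented (o : Arcs n) (o-ori : IsOrientation o) where
    open IsOrientation o-ori

    no-arc-off-I : ∀ u v → (I u ∨ I v) ≡ false → o u v ≡ false
    no-arc-off-I u v off = ¬-not λ ouv → case trans (sym (arc-meets-I u v ouv)) off of λ ()

    no-arc-off-edge : ∀ u v → adj G u v ≡ false → o u v ≡ false
    no-arc-off-edge u v uv = ¬-not λ ouv → case trans (sym (arc⇒adj u v ouv)) uv of λ ()

    𝟙-oriented : ∀ u v → (I u ∨ I v) ≡ true → 𝟙 (o u v) + 𝟙 (o v u) ≡ 𝟙 (adj G u v)
    𝟙-oriented u v meets with adj G u v in uv
    ... | true  rewrite oriented u v uv meets with o u v
    ...   | true  = refl
    ...   | false = refl
    𝟙-oriented u v meets | false =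
      cong₂ _+_ (cong 𝟙 (no-arc-off-edge u v uv)) (cong 𝟙 (no-arc-off-edge v u (trans (Graph.sym G v u) uv)))

    indeg-sum : sum (indeg o) ≡ sumOver I (deg G)
    indeg-sum = begin
      sum (λ v → count (λ u → o u v))
        ≡⟨ sum-cong-≗ (λ v → trans (count≡sum𝟙 (λ u → o u v)) (sum-cong-≗ (λ u → 𝟙-split (I u) (I v) (o u v)
             (arc-meets-I u v) λ ouv Iu Iv → case trans (sym (arc⇒adj u v ouv)) (I-indep u v Iu Iv) of λ ()))) ⟩
      sum (λ v → sum (λ u → A u v + B v u))
        ≡⟨ sum-cong-≗ (λ v → ∑-distrib-+ (λ u → A u v) (B v)) ⟩
      sum (λ v → sum (λ u → A u v) + sum (B v))
        ≡⟨ ∑-distrib-+ (λ v → sum (λ u → A u v)) (λ v → sum (B v)) ⟩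
      sum (λ v → sum (λ u → A u v)) + sum (λ u → sum (B u))
        ≡⟨ cong (_+ sum (λ u → sum (B u))) (∑-comm (λ v u → A u v)) ⟩
      sum (λ u → sum (A u)) + sum (λ u → sum (B u))
        ≡⟨ ∑-distrib-+ (λ u → sum (A u)) (λ u → sum (B u)) ⟨
      sum (λ u → sum (A u) + sum (B u))
        ≡⟨ sum-cong-≗ (λ u → trans (sym (∑-distrib-+ (A u) (B u))) (out+in u (I u) refl)) ⟩
      sum (λ u → if I u then deg G u else 0)
        ≡⟨ sumOver≡sum I (deg G) ⟨
      sumOver I (deg G) ∎
      where
      open ≡-Reasoning
      A B : Fin n → Fin n → ℕ
      A u v = 𝟙 (I u ∧ o u v)
      B u v = 𝟙 (I u ∧ o v u)
      out+in : ∀ u b → I u ≡ b → sum (λ v → 𝟙 (b ∧ o u v) + 𝟙 (b ∧ o v u)) ≡ (if b then deg G u else 0)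
      out+in u true  Iu = trans (sum-cong-≗ λ v → 𝟙-oriented u v (cong (_∨ I v) Iu)) (sym (count≡sum𝟙 (adj G u)))
      out+in u false Iu = trans (sum-const n 0) (*-zeroʳ n)

    D : Arcs n
    D u v = o u v ∨ (not (I u) ∧ not (I v) ∧ adj G u v)

    o⇒D : ∀ u v → o u v ≡ true → D u v ≡ true
    o⇒D u v ouv rewrite ouv = refl

    D-off-I : ∀ u v → I u ≡ false → I v ≡ false → adj G u v ≡ true → D u v ≡ true
    D-off-I u v Iu Iv uv rewrite Iu | Iv | uv = ∨-zeroʳ (o u v)

    D⇒adj : ∀ u v → D u v ≡ true → adj G u v ≡ true
    D⇒adj u v Duv with o u v in ouv
    ... | true  = arc⇒adj u v ouv
    ... | false = ∧-conicalʳ (not (I v)) _ (∧-conicalʳ (not (I u)) _ Duv)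

    D-sym-off-I : ∀ u v → I u ≡ false → I v ≡ false → D u v ≡ true → D v u ≡ true
    D-sym-off-I u v Iu Iv Duv = D-off-I v u Iv Iu (trans (Graph.sym G v u) (D⇒adj u v Duv))

    D-leaves-I : ∀ u v → I u ≡ true → D u v ≡ true → I v ≡ false
    D-leaves-I u v Iu Duv = ¬-not λ Iv → case trans (sym (D⇒adj u v Duv)) (I-indep u v Iu Iv) of λ ()

    oriented⇒D : ∀ u v → adj G u v ≡ true → (I u ∨ I v) ≡ true → D u v ≡ true ⊎ D v u ≡ true
    oriented⇒D u v uv meets with o u v in ouv
    ... | true  = inj₁ refl
    ... | false = inj₂ (o⇒D v u (trans (oriented u v uv meets) (cong not ouv)))

    adj⇒D : ∀ u v → adj G u v ≡ true → D u v ≡ true ⊎ D v u ≡ true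
    adj⇒D u v uv with I u ∨ I v in meets
    ... | true  = oriented⇒D u v uv meets
    ... | false = inj₁ (D-off-I u v (∨-conicalˡ _ _ meets) (∨-conicalʳ _ _ meets) uv)

    D-meets-I : ∀ v u → (I v ∨ I u) ≡ true → D v u ≡ o v u
    D-meets-I v u meets with I v | I u
    ... | true  | _     = ∨-identityʳ (o v u)
    ... | false | true  = ∨-identityʳ (o v u)

    𝟙-adj-split : ∀ v u → 𝟙 (adj G v u) ≡ 𝟙 (D v u) + 𝟙 (o u v)
    𝟙-adj-split v u with I v ∨ I u in meets
    ... | true  = trans (sym (𝟙-oriented v u meets)) (cong (λ b → 𝟙 b + 𝟙 (o u v)) (sym (D-meets-I v u meets)))
    ... | false rewrite no-arc-off-I v u meets | no-arc-off-I u v (trans (∨-comm (I u) (I v)) meets)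
                      | ∨-conicalˡ (I v) _ meets | ∨-conicalʳ (I v) _ meets = sym (+-identityʳ _)

    open KernelPerfection G D

    record Semikernel (X S : VSet n) : Set where
      field
        S⊆X       : S ⊆ X
        S-indep   : Independent G S
        S≠∅       : Nonempty S
        S-answers : ∀ s w → S s ≡ true → X w ≡ true → D s w ≡ true → ∃ λ s' → S s' ≡ true × D w s' ≡ true

    intoS : VSet n → Fin n → Bool
    intoS S u = ∃ᵇ λ s → S s ∧ D u s

    remainder : VSet n → VSet n → VSet n
    remainder X S u = X u ∧ not (S u) ∧ not (intoS S u)

    remainder-elim : ∀ X S u → remainder X S u ≡ true → X u ≡ true × S u ≡ false × intoS S u ≡ false
    remainder-elim X S u e =
      ∧-conicalˡ (X u) _ e ,
      not-injective {y = false} (∧-conicalˡ _ _ rest) ,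
      not-injective {y = false} (∧-conicalʳ (not (S u)) _ rest)
      where rest = ∧-conicalʳ (X u) _ e

    remainder-intro : ∀ X S u → X u ≡ true → S u ≡ false → intoS S u ≡ false → remainder X S u ≡ true
    remainder-intro X S u Xu Su Iu rewrite Xu | Su | Iu = refl

    remainder-< : ∀ {X S} → Semikernel X S → count (remainder X S) < count X
    remainder-< {X} {S} sk = count-mono-< (λ u e → proj₁ (remainder-elim X S u e)) s (S⊆X s Ss)
      (trans (cong (λ b → X s ∧ not b ∧ not (intoS S s)) Ss) (∧-zeroʳ (X s)))
      where
      open Semikernel sk
      s = proj₁ S≠∅
      Ss = proj₂ S≠∅

    semikernel∪kernel : ∀ {X S K} → Semikernel X S → Kernel (remainder X S) K → Kernel X (λ u → S u ∨ K u)
    semikernel∪kernel {X} {S} {K} sk (K⊆R , K-indep , K-absorbs) = S∪K⊆X , S∪K-indep , S∪K-absorbs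
      where
      open Semikernel sk
      S∪K⊆X : (λ u → S u ∨ K u) ⊆ X
      S∪K⊆X u e with S u in Su
      ... | true  = S⊆X u Su
      ... | false = proj₁ (remainder-elim X S u (K⊆R u e))
      -- A vertex of K has no arc into S, hence (S being a semikernel) no arc from S either.
      S-K-nonadjacent : ∀ s v → S s ≡ true → K v ≡ true → adj G s v ≡ false
      S-K-nonadjacent s v Ss Kv with (Xv , _ , ¬intoS) ← remainder-elim X S v (K⊆R v Kv) =
        ¬-not λ sv → case adj⇒D s v sv of λ where
          (inj₁ Dsv) → let (s' , Ss' , Dvs') = S-answers s v Ss Xv Dsv in
                       case trans (sym (∃ᵇ-intro s' (∧-intro Ss' Dvs'))) ¬intoS of λ ()
          (inj₂ Dvs) → case trans (sym (∃ᵇ-intro s (∧-intro Ss Dvs))) ¬intoS of λ ()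
      S∪K-indep : Independent G (λ u → S u ∨ K u)
      S∪K-indep u v eu ev with S u in Su | S v in Sv
      ... | true  | true  = S-indep u v Su Sv
      ... | true  | false = S-K-nonadjacent u v Su ev
      ... | false | true  = trans (Graph.sym G u v) (S-K-nonadjacent v u Sv eu)
      ... | false | false = K-indep u v eu ev
      S∪K-absorbs : Absorbs X (λ u → S u ∨ K u)
      S∪K-absorbs v Xv ¬S∪K with intoS S v in toS
      ... | true  = let (s , e) = ∃ᵇ-witness toS in s , cong (_∨ K s) (∧-conicalˡ (S s) _ e) , ∧-conicalʳ (S s) _ e
      ... | false = let (w , Kw , Dvw) = K-absorbs v (remainder-intro X S v Xv (∨-conicalˡ _ _ ¬S∪K) toS)
                                                      (∨-conicalʳ _ _ ¬S∪K)
                    in w , trans (cong (S w ∨_) Kw) (∨-zeroʳ (S w)) , Dvw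

    avoidsI : VSet n → Fin n → Bool
    avoidsI X v = X v ∧ not (I v) ∧ not (∃ᵇ λ x → X x ∧ I x ∧ D v x)

    semikernel-｛｝ : ∀ X v → avoidsI X v ≡ true → Semikernel X ｛ v ｝
    semikernel-｛｝ X v e = record
      { S⊆X = λ x x≡v → subst (λ y → X y ≡ true) (sym (∈｛｝ x≡v)) Xv
      ; S-indep = λ x y x≡v y≡v → subst₂ (λ a b → adj G a b ≡ false) (sym (∈｛｝ x≡v)) (sym (∈｛｝ y≡v)) (irrefl G v)
      ; S≠∅ = v , ｛｝-self v
      ; S-answers = answer
      }
      where
      Xv = ∧-conicalˡ (X v) _ e
      rest = ∧-conicalʳ (X v) _ e
      Iv = not-injective {y = false} (∧-conicalˡ _ _ rest)
      noArcIntoI = not-injective {y = false} (∧-conicalʳ (not (I v)) _ rest)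
      answer : ∀ s w → ｛ v ｝ s ≡ true → X w ≡ true → D s w ≡ true → ∃ λ s' → ｛ v ｝ s' ≡ true × D w s' ≡ true
      answer s w s≡v Xw Dsw with refl ← ∈｛｝ {v = v} {s} s≡v = by-I (I w) refl
        where
        by-I : ∀ b → I w ≡ b → ∃ λ s' → ｛ v ｝ s' ≡ true × D w s' ≡ true
        by-I true  Iw = case trans (sym (∃ᵇ-intro w (∧-intro Xw (∧-intro Iw Dsw)))) noArcIntoI of λ ()
        by-I false Iw = v , ｛｝-self v , D-sym-off-I v w Iv Iw Dsw

    semikernel-∩I : ∀ X → (∀ v → avoidsI X v ≡ false) → Nonempty X → Semikernel X (λ x → X x ∧ I x)
    semikernel-∩I X ¬avoids (x₀ , Xx₀) = record
      { S⊆X = λ x e → ∧-conicalˡ (X x) _ e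
      ; S-indep = λ u v eu ev → I-indep u v (∧-conicalʳ (X u) _ eu) (∧-conicalʳ (X v) _ ev)
      ; S≠∅ = nonempty
      ; S-answers = λ s w es Xw Dsw → arcIntoI w Xw (D-leaves-I s w (∧-conicalʳ (X s) _ es) Dsw)
      }
      where
      arcIntoI : ∀ w → X w ≡ true → I w ≡ false → ∃ λ x → (X x ∧ I x) ≡ true × D w x ≡ true
      arcIntoI w Xw Iw with ∃ᵇ (λ x → X x ∧ I x ∧ D w x) in E
      ... | false = case trans (sym (¬avoids w)) (∧-intro Xw (∧-intro (cong not Iw) (cong not E))) of λ ()
      ... | true  with (x , e) ← ∃ᵇ-witness E =
        x , ∧-intro (∧-conicalˡ (X x) _ e) (∧-conicalˡ (I x) _ (∧-conicalʳ (X x) _ e)) ,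
            ∧-conicalʳ (I x) _ (∧-conicalʳ (X x) _ e)
      nonempty : Nonempty (λ x → X x ∧ I x)
      nonempty with I x₀ in Ix₀
      ... | true  = x₀ , ∧-intro Xx₀ Ix₀
      ... | false = let (x , e , _) = arcIntoI x₀ Xx₀ Ix₀ in x , e

    semikernel-exists : ∀ X → Nonempty X → ∃ (Semikernel X)
    semikernel-exists X X≠∅ with ∃ᵇ (avoidsI X) in avoiders
    ... | true  = let (v , e) = ∃ᵇ-witness avoiders in ｛ v ｝ , semikernel-｛｝ X v e
    ... | false = _ , semikernel-∩I X (∃ᵇ-false avoiders) X≠∅

    D-kernelPerfect : KernelPerfect
    D-kernelPerfect X = go (count X) X ≤-refl
      where
      go : ∀ m X → count X ≤ m → ∃ (Kernel X)
      go m X |X|≤m with ∃ᵇ X in X≠∅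
      go m X |X|≤m | false =
        (λ _ → false) , (λ _ ()) , (λ _ _ ()) , λ v Xv _ → case trans (sym Xv) (∃ᵇ-false X≠∅ v) of λ ()
      go zero X |X|≤0 | true = ⊥-elim (<⇒≱ (count-pos X (∃ᵇ-witness X≠∅)) |X|≤0)
      go (suc m) X |X|≤m+1 | true with (S , sk) ← semikernel-exists X (∃ᵇ-witness X≠∅) =
        let (K , kernel) = go m (remainder X S) (≤-pred (≤-trans (remainder-< sk) |X|≤m+1)) in
        _ , semikernel∪kernel sk kernel

    degIn≡outdegIn+indeg : ∀ W → PredecessorClosed o W → ∀ v → W v ≡ true → degIn G W v ≡ outdegIn W v + indeg o v
    degIn≡outdegIn+indeg W closed v Wv = begin
      count (λ u → W u ∧ adj G v u)                          ≡⟨ count≡sum𝟙 (λ u → W u ∧ adj G v u) ⟩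
      sum (λ u → 𝟙 (W u ∧ adj G v u))                        ≡⟨ sum-cong-≗ (λ u → split u (W u) refl) ⟩
      sum (λ u → 𝟙 (W u ∧ D v u) + 𝟙 (o u v))
        ≡⟨ ∑-distrib-+ (λ u → 𝟙 (W u ∧ D v u)) (λ u → 𝟙 (o u v)) ⟩
      sum (λ u → 𝟙 (W u ∧ D v u)) + sum (λ u → 𝟙 (o u v))
        ≡⟨ cong₂ _+_ (count≡sum𝟙 (λ u → W u ∧ D v u)) (count≡sum𝟙 (λ u → o u v)) ⟨
      outdegIn W v + indeg o v                               ∎
      where
      open ≡-Reasoning
      split : ∀ u b → W u ≡ b → 𝟙 (b ∧ adj G v u) ≡ 𝟙 (b ∧ D v u) + 𝟙 (o u v)
      split u true  _  = 𝟙-adj-split v u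
      split u false Wu = cong 𝟙 (sym (¬-not λ ouv → case trans (sym (closed u v ouv Wv)) Wu of λ ()))

  reverse : Arcs n → Fin n → Fin n → Arcs n
  reverse o w v x y = if ｛ w ｝ x ∧ ｛ v ｝ y then false else if ｛ v ｝ x ∧ ｛ w ｝ y then true else o x y

  reverse-view : ∀ o w v x y → (x ≡ w × y ≡ v) ⊎ (x ≡ v × y ≡ w) ⊎ reverse o w v x y ≡ o x y
  reverse-view o w v x y with ｛ w ｝ x ∧ ｛ v ｝ y in wv
  ... | true  = inj₁ (∈｛｝ (∧-conicalˡ _ _ wv) , ∈｛｝ (∧-conicalʳ (｛ w ｝ x) _ wv))
  ... | false with ｛ v ｝ x ∧ ｛ w ｝ y in vw
  ...   | true  = inj₂ (inj₁ (∈｛｝ (∧-conicalˡ _ _ vw) , ∈｛｝ (∧-conicalʳ (｛ v ｝ x) _ vw)))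
  ...   | false = inj₂ (inj₂ refl)

  reverse-removes : ∀ o w v → reverse o w v w v ≡ false
  reverse-removes o w v rewrite ｛｝-self w | ｛｝-self v = refl

  reverse-adds : ∀ o w v → w ≢ v → reverse o w v v w ≡ true
  reverse-adds o w v w≢v rewrite ∉｛｝ (w≢v ∘ sym) | ｛｝-self v | ｛｝-self w = refl

  module Reversal (o : Arcs n) (o-ori : IsOrientation o) (w v : Fin n) (owv : o w v ≡ true) where
    open IsOrientation o-ori

    o' : Arcs n
    o' = reverse o w v

    w≢v : w ≢ v
    w≢v refl = case trans (sym (arc⇒adj w w owv)) (irrefl G w) of λ ()

    ¬ovw : o v w ≡ false
    ¬ovw = trans (oriented w v (arc⇒adj w v owv) (arc-meets-I w v owv)) (cong not owv)

    reverse-isOrientation : IsOrientation o'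
    reverse-isOrientation = record { arc⇒adj = arc⇒adj' ; arc-meets-I = arc-meets-I' ; oriented = oriented' }
      where
      arc⇒adj' : ∀ x y → o' x y ≡ true → adj G x y ≡ true
      arc⇒adj' x y o'xy with reverse-view o w v x y
      ... | inj₁ (refl , refl)        = case trans (sym o'xy) (reverse-removes o w v) of λ ()
      ... | inj₂ (inj₁ (refl , refl)) = trans (Graph.sym G v w) (arc⇒adj w v owv)
      ... | inj₂ (inj₂ o'≡o)          = arc⇒adj x y (trans (sym o'≡o) o'xy)
      arc-meets-I' : ∀ x y → o' x y ≡ true → (I x ∨ I y) ≡ true
      arc-meets-I' x y o'xy with reverse-view o w v x y
      ... | inj₁ (refl , refl)        = case trans (sym o'xy) (reverse-removes o w v) of λ ()
      ... | inj₂ (inj₁ (refl , refl)) = trans (∨-comm (I v) (I w)) (arc-meets-I w v owv)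
      ... | inj₂ (inj₂ o'≡o)          = arc-meets-I x y (trans (sym o'≡o) o'xy)
      oriented' : ∀ x y → adj G x y ≡ true → (I x ∨ I y) ≡ true → o' y x ≡ not (o' x y)
      oriented' x y xy meets with reverse-view o w v x y | reverse-view o w v y x
      ... | inj₁ (refl , refl)        | _ rewrite reverse-removes o w v | reverse-adds o w v w≢v = refl
      ... | inj₂ (inj₁ (refl , refl)) | _ rewrite reverse-removes o w v | reverse-adds o w v w≢v = refl
      ... | inj₂ (inj₂ _) | inj₁ (refl , refl)        rewrite reverse-removes o w v | reverse-adds o w v w≢v = refl
      ... | inj₂ (inj₂ _) | inj₂ (inj₁ (refl , refl)) rewrite reverse-removes o w v | reverse-adds o w v w≢v = refl
      ... | inj₂ (inj₂ o'xy≡oxy) | inj₂ (inj₂ o'yx≡oyx) =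
        trans o'yx≡oyx (trans (oriented x y xy meets) (cong not (sym o'xy≡oxy)))

    indeg-head : indeg o v ≡ suc (indeg o' v)
    indeg-head = count-suc-at (λ u → o u v) (λ u → o' u v) w owv (reverse-removes o w v) unchanged
      where
      unchanged : ∀ x → x ≢ w → o x v ≡ o' x v
      unchanged x x≢w with reverse-view o w v x v
      ... | inj₁ (x≡w , _)       = ⊥-elim (x≢w x≡w)
      ... | inj₂ (inj₁ (_ , v≡w)) = ⊥-elim (w≢v (sym v≡w))
      ... | inj₂ (inj₂ o'≡o)     = sym o'≡o

    indeg-tail : indeg o' w ≡ suc (indeg o w)
    indeg-tail = count-suc-at (λ u → o' u w) (λ u → o u w) v (reverse-adds o w v w≢v) ¬ovw unchanged
      where
      unchanged : ∀ x → x ≢ v → o' x w ≡ o x w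
      unchanged x x≢v with reverse-view o w v x w
      ... | inj₁ (_ , w≡v)       = ⊥-elim (w≢v w≡v)
      ... | inj₂ (inj₁ (x≡v , _)) = ⊥-elim (x≢v x≡v)
      ... | inj₂ (inj₂ o'≡o)     = o'≡o

    indeg-other : ∀ x → x ≢ v → x ≢ w → indeg o' x ≡ indeg o x
    indeg-other x x≢v x≢w = count-cong unchanged
      where
      unchanged : ∀ u → o' u x ≡ o u x
      unchanged u with reverse-view o w v u x
      ... | inj₁ (_ , x≡v)       = ⊥-elim (x≢v x≡v)
      ... | inj₂ (inj₁ (_ , x≡w)) = ⊥-elim (x≢w x≡w)
      ... | inj₂ (inj₂ o'≡o)     = o'≡o

  module Demand (g : Fin n → ℕ) where

    deficiency : Arcs n → ℕ
    deficiency o = sum (λ v → g v ∸ indeg o v)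

    deficient : Arcs n → VSet n
    deficient o v = indeg o v <ᵇ g v

    reachable : Arcs n → ℕ → VSet n
    reachable o zero    = deficient o
    reachable o (suc k) v = reachable o k v ∨ ∃ᵇ (λ u → reachable o k u ∧ o u v)

    reachable-suc : ∀ o k x → reachable o k x ≡ true → reachable o (suc k) x ≡ true
    reachable-suc o k x r rewrite r = refl

    reachable-arc : ∀ o k u x → reachable o k u ≡ true → o u x ≡ true → reachable o (suc k) x ≡ true
    reachable-arc o k u x r oux = trans (cong (reachable o k x ∨_) (∃ᵇ-intro u (∧-intro r oux))) (∨-zeroʳ _)

    deficient⇒reachable : ∀ o k x → deficient o x ≡ true → reachable o k x ≡ true
    deficient⇒reachable o zero    x d = d
    deficient⇒reachable o (suc k) x d = reachable-suc o k x (deficient⇒reachable o k x d)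

    reachable⇒deficient : ∀ o k x → reachable o k x ≡ true → Nonempty (deficient o)
    reachable⇒deficient o zero    x r = x , r
    reachable⇒deficient o (suc k) x r with reachable o k x in rx
    ... | true  = reachable⇒deficient o k x rx
    ... | false with (u , e) ← ∃ᵇ-witness r = reachable⇒deficient o k u (∧-conicalˡ _ _ e)

    SuccessorClosed : Arcs n → VSet n → Set
    SuccessorClosed o R = ∀ u x → R u ≡ true → o u x ≡ true → R x ≡ true

    -- Until the reached set is closed under arcs, every step adds a vertex.
    reachable-grows-or-closed : ∀ o k → k ≤ count (reachable o k) ⊎ SuccessorClosed o (reachable o k)
    reachable-grows-or-closed o zero = inj₁ z≤n
    reachable-grows-or-closed o (suc k) with ∃ᵇ (λ x → reachable o (suc k) x ∧ not (reachable o k x)) in new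
    ... | false = inj₂ λ u x ru oux → reachable-arc o k u x (no-new u ru) oux
      where
      no-new : ∀ x → reachable o (suc k) x ≡ true → reachable o k x ≡ true
      no-new x r = not-injective {y = true}
        (trans (cong (_∧ not (reachable o k x)) (sym r)) (∃ᵇ-false new x))
    ... | true = let (x , e) = ∃ᵇ-witness new in
      inj₁ (grows x (∧-conicalˡ _ _ e) (not-injective {y = false} (∧-conicalʳ (reachable o (suc k) x) _ e))
                  (reachable-grows-or-closed o k))
      where
      grows : ∀ x → reachable o (suc k) x ≡ true → reachable o k x ≡ false →
              k ≤ count (reachable o k) ⊎ SuccessorClosed o (reachable o k) → suc k ≤ count (reachable o (suc k))
      grows x reached ¬rx (inj₁ k≤count) = <-≤-trans (s≤s k≤count) (count-mono-< (reachable-suc o k) x reached ¬rx)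
      grows x reached ¬rx (inj₂ closed)
        with (u , e) ← ∃ᵇ-witness (trans (cong (_∨ ∃ᵇ (λ u → reachable o k u ∧ o u x)) (sym ¬rx)) reached) =
        case trans (sym (closed u x (∧-conicalˡ _ _ e) (∧-conicalʳ (reachable o k u) _ e))) ¬rx of λ ()

    module ReversalEffect (o : Arcs n) (o-ori : IsOrientation o) (w v : Fin n) (owv : o w v ≡ true)
                          (v-surplus : g v < indeg o v) where
      open Reversal o o-ori w v owv public

      deficiency-reverse-pointwise : ∀ x → g x ∸ indeg o' x ≤ g x ∸ indeg o x
      deficiency-reverse-pointwise x = by-cases (x ≟ᶠ v) (x ≟ᶠ w)
        where
        by-cases : Dec (x ≡ v) → Dec (x ≡ w) → g x ∸ indeg o' x ≤ g x ∸ indeg o x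
        by-cases (yes refl) _ rewrite m≤n⇒m∸n≡0 (≤-pred (subst (g x <_) indeg-head v-surplus)) = z≤n
        by-cases (no _) (yes refl) rewrite indeg-tail = ∸-monoʳ-≤ (g x) (n≤1+n _)
        by-cases (no x≢v) (no x≢w) rewrite indeg-other x x≢v x≢w = ≤-refl

      deficiency-reverse-≤ : deficiency o' ≤ deficiency o
      deficiency-reverse-≤ = sum-mono-≤ deficiency-reverse-pointwise

      deficiency-reverse-< : indeg o w < g w → deficiency o' < deficiency o
      deficiency-reverse-< w-deficient = sum-mono-< deficiency-reverse-pointwise w
        (subst (λ d → g w ∸ d < g w ∸ indeg o w) (sym indeg-tail) (∸-monoʳ-< (n<1+n _) w-deficient))

      module _ (w-met : g w ≤ indeg o w) where

        deficient-preserved : ∀ x → deficient o x ≡ true → deficient o' x ≡ true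
        deficient-preserved x dx = by-cases (x ≟ᶠ v) (x ≟ᶠ w)
          where
          by-cases : Dec (x ≡ v) → Dec (x ≡ w) → deficient o' x ≡ true
          by-cases (yes refl) _          = ⊥-elim (<-asym v-surplus (<ᵇ-true⇒< dx))
          by-cases (no _)     (yes refl) = ⊥-elim (<⇒≱ (<ᵇ-true⇒< dx) w-met)
          by-cases (no x≢v)   (no x≢w) rewrite indeg-other x x≢v x≢w = dx

        -- A path that uses the reversed arc w → v passes through w.
        reachable-preserved : ∀ j x → reachable o j x ≡ true → reachable o' j x ≡ true ⊎ reachable o' j w ≡ true
        reachable-preserved zero x r = inj₁ (deficient-preserved x r)
        reachable-preserved (suc j) x r with reachable o j x in rx
        ... | true with reachable-preserved j x rx
        ...   | inj₁ r' = inj₁ (reachable-suc o' j x r')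
        ...   | inj₂ r' = inj₂ (reachable-suc o' j w r')
        reachable-preserved (suc j) x r | false with (y , e) ← ∃ᵇ-witness r
          with reachable-preserved j y (∧-conicalˡ _ _ e) | reverse-view o w v y x
        ... | inj₂ rw' | _                          = inj₂ (reachable-suc o' j w rw')
        ... | inj₁ ry' | inj₁ (refl , _)            = inj₂ (reachable-suc o' j w ry')
        ... | inj₁ _   | inj₂ (inj₁ (refl , refl)) = case trans (sym (∧-conicalʳ (reachable o j v) _ e)) ¬ovw of λ ()
        ... | inj₁ ry' | inj₂ (inj₂ o'≡o)          =
          inj₁ (reachable-arc o' j y x ry' (trans o'≡o (∧-conicalʳ (reachable o j y) _ e)))

    -- Reversing a path from a deficient to a surplus vertex, one arc at a time from the surplus end.
    reachable-surplus⇒improvable : ∀ k o → IsOrientation o → ∀ v → reachable o k v ≡ true → g v < indeg o v →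
                                   ∃ λ o' → IsOrientation o' × deficiency o' < deficiency o
    reachable-surplus⇒improvable zero o o-ori v dv v-surplus = ⊥-elim (<-asym v-surplus (<ᵇ-true⇒< dv))
    reachable-surplus⇒improvable (suc k) o o-ori v r v-surplus with reachable o k v in rv
    ... | true  = reachable-surplus⇒improvable k o o-ori v rv v-surplus
    ... | false = let (w , e) = ∃ᵇ-witness r in
                  reverse-last-arc w (∧-conicalˡ _ _ e) (∧-conicalʳ (reachable o k w) _ e)
      where
      reverse-last-arc : ∀ w → reachable o k w ≡ true → o w v ≡ true →
                         ∃ λ o' → IsOrientation o' × deficiency o' < deficiency o
      reverse-last-arc w rw owv = by-demand (g w ≤? indeg o w)
        where
        open ReversalEffect o o-ori w v owv v-surplus
        by-demand : Dec (g w ≤ indeg o w) → ∃ λ o' → IsOrientation o' × deficiency o' < deficiency o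
        by-demand (no w-deficient) = o' , reverse-isOrientation , deficiency-reverse-< (≰⇒> w-deficient)
        by-demand (yes w-met) =
          let (o'' , o''-ori , improved) = reachable-surplus⇒improvable k o' reverse-isOrientation w rw'
                                             (subst (g w <_) (sym indeg-tail) (s≤s w-met))
          in o'' , o''-ori , <-≤-trans improved deficiency-reverse-≤
          where
          rw' : reachable o' k w ≡ true
          rw' with reachable-preserved w-met k w rw
          ... | inj₁ r' = r'
          ... | inj₂ r' = r'

    record SaturatedSet : Set where
      field
        orientation   : Arcs n
        isOrientation : IsOrientation orientation
        W             : VSet n
        W≠∅           : Nonempty W
        demand-met    : ∀ v → W v ≡ true → g v ≤ indeg orientation v
        closed        : PredecessorClosed orientation W

    module _ (v₀ : Fin n) (enough : sum g ≤ sumOver I (deg G)) where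

      unreachable-saturated : ∀ o → IsOrientation o →
        (∀ v → reachable o (suc n) v ≡ true → indeg o v ≤ g v) → SaturatedSet
      unreachable-saturated o o-ori no-surplus = record
        { orientation = o ; isOrientation = o-ori ; W = W ; W≠∅ = W≠∅ ; demand-met = demand-met ; closed = closed }
        where
        R = reachable o (suc n)
        W : VSet n
        W v = not (R v)
        R-closed : SuccessorClosed o R
        R-closed with reachable-grows-or-closed o (suc n)
        ... | inj₁ n<count = ⊥-elim (<⇒≱ (s≤s (count≤size R)) n<count)
        ... | inj₂ closed  = closed
        closed : PredecessorClosed o W
        closed u v ouv Wv with R u in Ru
        ... | false = refl
        ... | true  = case trans (sym (cong not (R-closed u v Ru ouv))) Wv of λ ()
        demand-met : ∀ v → W v ≡ true → g v ≤ indeg o v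
        demand-met v Wv with deficient o v in dv
        ... | false = <ᵇ-false⇒≥ dv
        ... | true  = case trans (sym (cong not (deficient⇒reachable o (suc n) v dv))) Wv of λ ()
        W≠∅ : Nonempty W
        W≠∅ with ∃ᵇ W in W-inhabited
        ... | true  = ∃ᵇ-witness W-inhabited
        ... | false = ⊥-elim (<⇒≱ (sum-mono-< indeg≤g z (<ᵇ-true⇒< dz))
                                 (subst (sum g ≤_) (sym (Oriented.indeg-sum o o-ori)) enough))
          where
          all-reachable : ∀ v → R v ≡ true
          all-reachable v = not-injective {y = true} (∃ᵇ-false W-inhabited v)
          indeg≤g : ∀ v → indeg o v ≤ g v
          indeg≤g v = no-surplus v (all-reachable v)
          z = proj₁ (reachable⇒deficient o (suc n) v₀ (all-reachable v₀))
          dz = proj₂ (reachable⇒deficient o (suc n) v₀ (all-reachable v₀))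

      saturated-set-exists : SaturatedSet
      saturated-set-exists = go (suc (deficiency outward)) outward ≤-refl outward-isOrientation
        where
        go : ∀ m o → deficiency o < m → IsOrientation o → SaturatedSet
        go (suc m) o bound o-ori with ∃ᵇ (λ v → reachable o (suc n) v ∧ (g v <ᵇ indeg o v)) in surplus
        ... | false = unreachable-saturated o o-ori λ v rv →
          <ᵇ-false⇒≥ (trans (cong (_∧ (g v <ᵇ indeg o v)) (sym rv)) (∃ᵇ-false surplus v))
        ... | true = let (v , e) = ∃ᵇ-witness surplus
                         (o' , o'-ori , improved) = reachable-surplus⇒improvable (suc n) o o-ori v
                                                      (∧-conicalˡ _ _ e) (<ᵇ-true⇒< (∧-conicalʳ (reachable o (suc n) v) _ e))
                     in go m o' (<-≤-trans improved (≤-pred bound)) o'-ori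

-- Degrees

allF-elim : ∀ {n} (p : VSet n) → allF p ≡ true → ∀ v → p v ≡ true
allF-elim p all fz     = ∧-conicalˡ (p fz) _ all
allF-elim p all (fs v) = allF-elim (p ∘ fs) (∧-conicalʳ (p fz) _ all) v

independentᵇ-sound : ∀ {n} (G : Graph n) I → independentᵇ G I ≡ true → Independent G I
independentᵇ-sound G I ind u v Iu Iv = not-injective {y = false} (begin
  not (adj G u v)                   ≡⟨ cong (λ b → not (b ∧ adj G u v)) (sym Iv) ⟩
  not (I v ∧ adj G u v)             ≡⟨ cong (λ b → not (b ∧ I v ∧ adj G u v)) (sym Iu) ⟩
  not (I u ∧ I v ∧ adj G u v)       ≡⟨ allF-elim _ (allF-elim _ ind u) v ⟩
  true                              ∎)
  where open ≡-Reasoning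

foldr-⊔-< : ∀ {A : Set} (p : A → Bool) (h : A → ℕ) {b} → 0 < b → (∀ a → p a ≡ true → h a < b) →
            ∀ as → foldr (λ a k → if p a then h a ⊔ k else k) 0 as < b
foldr-⊔-< p h 0<b h<b []       = 0<b
foldr-⊔-< p h 0<b h<b (a ∷ as) with p a in pa
... | true  = ⊔-pres-<m (h<b a pa) (foldr-⊔-< p h 0<b h<b as)
... | false = foldr-⊔-< p h 0<b h<b as

mic-< : ∀ {n} (G : Graph n) {b} → 0 < b → (∀ I → Independent G I → sumOver I (deg G) < b) → mic G < b
mic-< {n} G 0<b bound = foldr-⊔-< (independentᵇ G) (λ I → sumOver I (deg G)) 0<b
  (λ I ind → bound I (independentᵇ-sound G I ind)) (allSubsets n)

handshake : ∀ {n} (G : Graph n) → 2 * numEdges G ≡ sum (deg G)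
handshake {n} G = begin
  2 * numEdges G
    ≡⟨ cong (λ x → x + (x + 0)) (trans (sumOver≡sum full ordered-nbrs)
                                       (sum-cong-≗ (λ u → count≡sum𝟙 (λ v → u ≺ v ∧ adj G u v)))) ⟩
  E + (E + 0)                                     ≡⟨ cong (_+_ E) (+-identityʳ E) ⟩
  E + E                                           ≡⟨ cong (_+_ E) (∑-comm (λ u v → 𝟙 (v ≺ u ∧ adj G v u))) ⟨
  E + sum (λ u → sum (λ v → 𝟙 (v ≺ u ∧ adj G v u)))
    ≡⟨ cong (_+_ E) (sum-cong-≗ (λ u → sum-cong-≗ (λ v → cong (λ b → 𝟙 (v ≺ u ∧ b)) (Graph.sym G v u)))) ⟩
  E + sum (λ u → sum (λ v → 𝟙 (v ≺ u ∧ adj G u v)))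
    ≡⟨ ∑-distrib-+ (λ u → sum (λ v → 𝟙 (u ≺ v ∧ adj G u v))) (λ u → sum (λ v → 𝟙 (v ≺ u ∧ adj G u v))) ⟨
  sum (λ u → sum (λ v → 𝟙 (u ≺ v ∧ adj G u v)) + sum (λ v → 𝟙 (v ≺ u ∧ adj G u v)))
    ≡⟨ sum-cong-≗ (λ u → ∑-distrib-+ (λ v → 𝟙 (u ≺ v ∧ adj G u v)) (λ v → 𝟙 (v ≺ u ∧ adj G u v))) ⟨
  sum (λ u → sum (λ v → 𝟙 (u ≺ v ∧ adj G u v) + 𝟙 (v ≺ u ∧ adj G u v)))
    ≡⟨ sum-cong-≗ (λ u → sum-cong-≗ (λ v → split u v)) ⟨
  sum (λ u → sum (λ v → 𝟙 (adj G u v)))           ≡⟨ sum-cong-≗ (λ u → count≡sum𝟙 (adj G u)) ⟨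
  sum (deg G)                                     ∎
  where
  open ≡-Reasoning
  _≺_ : Fin n → Fin n → Bool
  u ≺ v = toℕ u <ᵇ toℕ v
  ordered-nbrs : Fin n → ℕ
  ordered-nbrs u = count (λ v → u ≺ v ∧ adj G u v)
  E : ℕ
  E = sum (λ u → sum (λ v → 𝟙 (u ≺ v ∧ adj G u v)))
  split : ∀ u v → 𝟙 (adj G u v) ≡ 𝟙 (u ≺ v ∧ adj G u v) + 𝟙 (v ≺ u ∧ adj G u v)
  split u v = 𝟙-split (u ≺ v) (v ≺ u) (adj G u v) comparable
    λ _ u≺v v≺u → <-asym (<ᵇ-true⇒< {toℕ u} u≺v) (<ᵇ-true⇒< {toℕ v} v≺u)
    where
    comparable : adj G u v ≡ true → (u ≺ v ∨ v ≺ u) ≡ true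
    comparable uv with <-cmp (toℕ u) (toℕ v)
    ... | tri< u<v _ _ = cong (_∨ v ≺ u) (Equivalence.to T-≡ (<⇒<ᵇ u<v))
    ... | tri> _ _ v<u = trans (cong (u ≺ v ∨_) (Equivalence.to T-≡ (<⇒<ᵇ v<u))) (∨-zeroʳ _)
    ... | tri≈ _ u≡v _ with refl ← toℕ-injective u≡v = case trans (sym uv) (irrefl G u) of λ ()

suc≤[d+[o+i]]∸[d+b] : ∀ d o i b → suc b ≤ i → suc o ≤ d + (o + i) ∸ (d + b)
suc≤[d+[o+i]]∸[d+b] d o i b b<i = begin
  suc o                  ≡⟨ +-comm 1 o ⟩
  o + 1                  ≡⟨ cong (_+_ o) (m+n∸n≡m 1 b) ⟨
  o + (suc b ∸ b)        ≤⟨ +-monoʳ-≤ o (∸-monoˡ-≤ b b<i) ⟩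
  o + (i ∸ b)            ≡⟨ +-∸-assoc o (≤-trans (n≤1+n b) b<i) ⟨
  o + i ∸ b              ≡⟨ [m+n]∸[m+o]≡n∸o d (o + i) b ⟨
  d + (o + i) ∸ (d + b)  ∎
  where open ≤-Reasoning

minF-≤ : ∀ {n} (f : Fin (suc n) → ℕ) v → minF f ≤ f v
minF-≤ {zero}  f fz     = ≤-refl
minF-≤ {suc n} f fz     = m⊓n≤m _ _
minF-≤ {suc n} f (fs v) = ≤-trans (m⊓n≤n (f fz) _) (minF-≤ (f ∘ fs) v)

maxF-≥ : ∀ {n} (f : Fin n → ℕ) v → f v ≤ maxF f
maxF-≥ {suc n} f fz     = m≤m⊔n _ _
maxF-≥ {suc n} f (fs v) = ≤-trans (maxF-≥ (f ∘ fs) v) (m≤n⊔m (f fz) _)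

module NearlyRegular {m} (G : Graph (suc m)) (Δ≡δ+1 : maxdeg G ≡ mindeg G + 1) where

  δ : ℕ
  δ = mindeg G

  H L : VSet (suc m)
  H = Hset G
  L = Lset G

  deg≡δ+𝟙H : ∀ v → deg G v ≡ δ + 𝟙 (H v)
  deg≡δ+𝟙H v with H v in Hv
  ... | true  = ≤-antisym (subst (deg G v ≤_) Δ≡δ+1 (maxF-≥ (deg G) v)) (subst (_≤ deg G v) (+-comm 1 δ) (<ᵇ-true⇒< Hv))
  ... | false = trans (≤-antisym (<ᵇ-false⇒≥ Hv) (minF-≤ (deg G) v)) (sym (+-identityʳ δ))

  𝟙H+𝟙L≡1 : ∀ v → 𝟙 (H v) + 𝟙 (L v) ≡ 1
  𝟙H+𝟙L≡1 v with H v | deg≡δ+𝟙H v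
  ... | true  | d≡δ+1 rewrite d≡δ+1 =
    cong (λ b → 1 + 𝟙 b) (¬-not λ e → m+1+n≢m δ (≡ᵇ⇒≡ (δ + 1) δ (Equivalence.from T-≡ e)))
  ... | false | d≡δ+0 rewrite d≡δ+0 | +-identityʳ δ = cong 𝟙 (Equivalence.to T-≡ (≡⇒≡ᵇ δ δ refl))

  |H|+|L|≡n : count H + count L ≡ suc m
  |H|+|L|≡n = begin
    count H + count L              ≡⟨ cong₂ _+_ (count≡sum𝟙 H) (count≡sum𝟙 L) ⟩
    sum (𝟙 ∘ H) + sum (𝟙 ∘ L)      ≡⟨ ∑-distrib-+ (𝟙 ∘ H) (𝟙 ∘ L) ⟨
    sum (λ v → 𝟙 (H v) + 𝟙 (L v))  ≡⟨ sum-cong-≗ 𝟙H+𝟙L≡1 ⟩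
    sum {suc m} (λ _ → 1)          ≡⟨ sum-const (suc m) 1 ⟩
    suc m * 1                      ≡⟨ *-identityʳ (suc m) ⟩
    suc m                          ∎
    where open ≡-Reasoning

  sumOver-H-deg : sumOver H (deg G) ≡ count H * (δ + 1)
  sumOver-H-deg = begin
    sumOver H (deg G)                          ≡⟨ sumOver≡sum H (deg G) ⟩
    sum (λ v → if H v then deg G v else 0)     ≡⟨ sum-cong-≗ (λ v → on-H v (H v) refl) ⟩
    sum (λ v → 𝟙 (H v) * (δ + 1))              ≡⟨ sum-*ʳ (𝟙 ∘ H) (δ + 1) ⟩
    sum (𝟙 ∘ H) * (δ + 1)                      ≡⟨ cong (_* (δ + 1)) (count≡sum𝟙 H) ⟨
    count H * (δ + 1)                          ∎
    where
    open ≡-Reasoning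
    on-H : ∀ v b → H v ≡ b → (if b then deg G v else 0) ≡ 𝟙 b * (δ + 1)
    on-H v true  Hv = trans (trans (deg≡δ+𝟙H v) (cong (λ b → δ + 𝟙 b) Hv)) (sym (+-identityʳ (δ + 1)))
    on-H v false _  = refl

  sum-deg : sum (deg G) ≡ suc m * δ + count H
  sum-deg = begin
    sum (deg G)                   ≡⟨ sum-cong-≗ deg≡δ+𝟙H ⟩
    sum (λ v → δ + 𝟙 (H v))       ≡⟨ ∑-distrib-+ {suc m} (λ _ → δ) (𝟙 ∘ H) ⟩
    sum {suc m} (λ _ → δ) + sum (𝟙 ∘ H) ≡⟨ cong₂ _+_ (sum-const (suc m) δ) (sym (count≡sum𝟙 H)) ⟩
    suc m * δ + count H           ∎
    where open ≡-Reasoning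

  independent-degree-sum-< : OCIrreducible G → ∀ I → Independent G I → sumOver I (deg G) < count H + suc m
  independent-degree-sum-< irreducible I I-indep with sumOver I (deg G) <? count H + suc m
  ... | yes below = below
  ... | no ¬below = ⊥-elim (irreducible W (W≠∅ , W-choosable))
    where
    open Orientations G I I-indep
    g : Fin (suc m) → ℕ
    g v = suc (𝟙 (H v))
    sum-g : sum g ≡ count H + suc m
    sum-g = begin
      sum g                          ≡⟨ ∑-distrib-+ {suc m} (λ _ → 1) (𝟙 ∘ H) ⟩
      sum {suc m} (λ _ → 1) + sum (𝟙 ∘ H)
        ≡⟨ cong₂ _+_ (trans (sum-const (suc m) 1) (*-identityʳ (suc m))) (sym (count≡sum𝟙 H)) ⟩
      suc m + count H                ≡⟨ +-comm (suc m) (count H) ⟩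
      count H + suc m                ∎
      where open ≡-Reasoning
    open Demand g
    open SaturatedSet (saturated-set-exists fz (subst (_≤ sumOver I (deg G)) (sym sum-g) (≮⇒≥ ¬below)))
    open Oriented orientation isOrientation
    open KernelPerfection G D
    W-choosable : OnlineChoosable G W (fH G W)
    W-choosable = kernelPerfect⇒onlineChoosable D-kernelPerfect W (fH G W) λ v Wv →
      subst₂ (λ a b → suc (outdegIn W v) ≤ δ + a ∸ b) (sym (degIn≡outdegIn+indeg W closed v Wv)) (sym (deg≡δ+𝟙H v))
        (suc≤[d+[o+i]]∸[d+b] δ (outdegIn W v) (indeg orientation v) (𝟙 (H v)) (demand-met v Wv))

  δ|H|<|G| : OCIrreducible G → HEdgeless G → δ * count H < suc m
  δ|H|<|G| irreducible H-edgeless = +-cancelˡ-< (count H) _ _ (begin-strict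
    count H + δ * count H   ≡⟨ cong (_+_ (count H)) (*-comm δ (count H)) ⟩
    count H + count H * δ   ≡⟨ +-comm (count H) _ ⟩
    count H * δ + count H   ≡⟨ cong (_+_ (count H * δ)) (*-identityʳ (count H)) ⟨
    count H * δ + count H * 1 ≡⟨ *-distribˡ-+ (count H) δ 1 ⟨
    count H * (δ + 1)       ≡⟨ sumOver-H-deg ⟨
    sumOver H (deg G)       <⟨ independent-degree-sum-< irreducible H H-edgeless ⟩
    count H + suc m         ∎)
    where open ≤-Reasoning

-- Integer and rational arithmetic

[d-1]*h<l : ∀ d h l → d * h < h + l → (+ d -ℤ + 1) *ℤ + h <ℤ + l
[d-1]*h<l zero    zero    l 0<l = +<+ 0<l
[d-1]*h<l zero    (suc h) l _   = -<+
[d-1]*h<l (suc d) h       l lt  = subst (_<ℤ + l) (ℤ.pos-* d h) (+<+ (+-cancelˡ-< h (d * h) l lt))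

toℚᵘ-/ : ∀ i m → toℚᵘ (i / suc m) ≃ mkℚᵘ i m
toℚᵘ-/ i m = *≡* (begin
    ↥ᵘ (toℚᵘ p) *ℤ + suc m ≡⟨ cong (_*ℤ + suc m) (↥ᵘ-toℚᵘ p) ⟩
    ↥ p *ℤ + suc m        ≡⟨ cong (↥ p *ℤ_) (↧-/ i (suc m)) ⟨
    ↥ p *ℤ (↧ p *ℤ g)     ≡⟨ x∙yz≈xz∙y (↥ p) (↧ p) g ⟩
    ↥ p *ℤ g *ℤ ↧ p       ≡⟨ cong (_*ℤ ↧ p) (↥-/ i (suc m)) ⟩
    i *ℤ ↧ p              ≡⟨ cong (i *ℤ_) (↧ᵘ-toℚᵘ p) ⟨
    i *ℤ ↧ᵘ (toℚᵘ p)      ∎)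
  where
  open ≡-Reasoning
  p = i / suc m
  g = gcd i (+ suc m)

-- Shapes such as suc ((d' + 0) * 1) below are the normal forms of the cross products in the goal.
mkℚᵘ-bound : ∀ d' n h → suc d' * h < n →
  mkℚᵘ (+ (n * suc d' + h)) 0 ℚᵘ.< (mkℚᵘ (+ suc d') 0 ℚᵘ.+ mkℚᵘ (+ 1) d') ℚᵘ.* mkℚᵘ (+ n) 0
mkℚᵘ-bound d' n h dh<n = *<* (subst₂ _<ℤ_ (ℤ.pos-* X (suc ((d' + 0) * 1))) rhs (+<+ ineq))
  where
  D = suc d'
  X = n * D + h
  rhs : + ((D * D + 1 * 1) * n * 1) ≡ ((+ D *ℤ + D +ℤ + 1 *ℤ + 1) *ℤ + n) *ℤ + 1
  rhs = begin
    + ((D * D + 1 * 1) * n * 1)           ≡⟨ ℤ.pos-* ((D * D + 1 * 1) * n) 1 ⟩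
    + ((D * D + 1 * 1) * n) *ℤ + 1        ≡⟨ cong (_*ℤ + 1) (ℤ.pos-* (D * D + 1 * 1) n) ⟩
    (+ (D * D + 1 * 1) *ℤ + n) *ℤ + 1     ≡⟨ cong (λ z → (z *ℤ + n) *ℤ + 1) (ℤ.pos-+ (D * D) (1 * 1)) ⟩
    ((+ (D * D) +ℤ + (1 * 1)) *ℤ + n) *ℤ + 1 ≡⟨ cong (λ z → (z *ℤ + n) *ℤ + 1) (cong₂ _+ℤ_ (ℤ.pos-* D D) (ℤ.pos-* 1 1)) ⟩
    ((+ D *ℤ + D +ℤ + 1 *ℤ + 1) *ℤ + n) *ℤ + 1 ∎
    where open ≡-Reasoning
  expandˡ : ∀ n d' h → (n * suc d' + h) * suc ((d' + 0) * 1) ≡ n * suc d' * suc d' + suc d' * h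
  expandˡ = solve-∀
  expandʳ : ∀ n d' → (suc d' * suc d' + 1 * 1) * n * 1 ≡ n * suc d' * suc d' + n
  expandʳ = solve-∀
  ineq : X * suc ((d' + 0) * 1) < (D * D + 1 * 1) * n * 1
  ineq = subst₂ _<_ (sym (expandˡ n d' h)) (sym (expandʳ n d')) (+-monoʳ-< (n * D * D) dh<n)

n*d+h<[d+1/d]*n : ∀ d .{{_ : NonZero d}} n h → d * h < n →
  (+ (n * d + h)) / 1 <ℚ ((+ d) / 1 +ℚ (+ 1) / d) *ℚ ((+ n) / 1)
n*d+h<[d+1/d]*n zero n h _ = ⊥-elim (≢-nonZero⁻¹ 0 refl)
n*d+h<[d+1/d]*n (suc d') n h dh<n =
  toℚᵘ-cancel-< (ℚᵘ.<-respˡ-≃ (ℚᵘ.≃-sym (toℚᵘ-/ _ 0))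
                 (ℚᵘ.<-respʳ-≃ (ℚᵘ.≃-sym rhs) (mkℚᵘ-bound d' n h dh<n)))
  where
  D = suc d'
  rhs : toℚᵘ (((+ D) / 1 +ℚ (+ 1) / D) *ℚ ((+ n) / 1)) ≃
        (mkℚᵘ (+ D) 0 ℚᵘ.+ mkℚᵘ (+ 1) d') ℚᵘ.* mkℚᵘ (+ n) 0
  rhs = ℚᵘ.≃-trans (toℚᵘ-homo-* ((+ D) / 1 +ℚ (+ 1) / D) ((+ n) / 1))
          (ℚᵘ.*-cong (ℚᵘ.≃-trans (toℚᵘ-homo-+ ((+ D) / 1) ((+ 1) / D))
                                 (ℚᵘ.+-cong (toℚᵘ-/ (+ D) 0) (toℚᵘ-/ (+ 1) d')))
                     (toℚᵘ-/ (+ n) 0))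

lemma3p1 : ∀ {n} (G : Graph n) →
    OCIrreducible G →
    HEdgeless G →
    maxdeg G ≡ mindeg G + 1 →
    (mic G < count (Hset G) + n) ×
    (((+ mindeg G -ℤ + 1) *ℤ (+ count (Hset G)) <ℤ + count (Lset G)) ×
     (.{{_ : NonZero (mindeg G)}} →
        ((+ (2 * numEdges G)) / 1) <ℚ
          (((+ mindeg G) / 1 +ℚ (+ 1) / mindeg G) *ℚ ((+ n) / 1))))
lemma3p1 {zero}  G _ _ ()
lemma3p1 {suc m} G irreducible H-edgeless Δ≡δ+1 =
  mic-< G (≤-trans (s≤s z≤n) (m≤n+m (suc m) (count H))) (independent-degree-sum-< irreducible) ,
  [d-1]*h<l δ (count H) (count L) (subst (δ * count H <_) (sym |H|+|L|≡n) δ|H|<n) ,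
  λ where ⦃ _ ⦄ → subst (λ e → (+ e) / 1 <ℚ ((+ δ) / 1 +ℚ (+ 1) / δ) *ℚ ((+ suc m) / 1))
                   (sym (trans (handshake G) sum-deg)) (n*d+h<[d+1/d]*n δ (suc m) (count H) δ|H|<n)
  where
  open NearlyRegular G Δ≡δ+1
  δ|H|<n : δ * count H < suc m
  δ|H|<n = δ|H|<|G| irreducible H-edgeless
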